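{- Let $(A,V)$ and $(B,W)$ be permutation groups on finite sets, neither equal to $I_1$. Let $G(A\times B)$ be the edge-colored graph on $V\times W$ in which two edges $\{x,y\},\{x',y'\}$ receive the same color if and only if they lie in the same NOr-orbital of the direct product $A\times B$ (distinct NOr-orbitals receiving distinct colors). Then $$A\times B\subseteq \mathrm{Aut}(G(A\times B))\subseteq \bar{A}\times\bar{B}.$$
   Context: A permutation group $(A,V)$ is a group $A$ of permutations of a set $V$; $I_n$ denotes the trivial group acting on an $n$-element set. The direct product $A\times B$ of $(A,V)$ and $(B,W)$ acts on $V\times W$ by $(a,b)(x,y)=(a(x),b(y))$. $P_2(V)$ is the set of 2-element subsets of $V$. An edge-colored graph on $V$ is a function $E$ from $P_2(V)$ to a finite set of colors; its automorphisms are the permutations $\sigma$ of $V$ with $E(\{\sigma(v),\sigma(w)\})=E(\{v,w\})$ for all distinct $v,w$. $GR$ is the class of permutation groups that equal the full automorphism group of some edge-colored graph on their underlying set. The NOr-orbitals of a permutation group $(C,U)$ are the orbits of $C$ acting on $P_2(U)$ by $c\{u,u'\}=\{c(u),c(u')\}$. $\bar{A}$ denotes the smallest permutation group on $V$ containing $A$ and belonging to $GR$ (equivalently, the group of all permutations of $V$ mapping every NOr-orbital of $A$ onto itself). -}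

module Defs where

open import Level using (0ℓ)
open import Data.Nat using (ℕ)
open import Data.Fin using (Fin)
open import Data.Product using (_×_; _,_; ∃; ∃₂; Σ)
open import Data.Sum using (_⊎_)
open import Relation.Binary.PropositionalEquality using (_≡_; _≢_)
open import Relation.Nullary using (¬_)
open import Function.Bundles using (_↔_; Inverse)
open import Function.Construct.Identity using (↔-id)
open import Function.Construct.Composition using (_↔-∘_)
open import Function.Construct.Symmetry using (↔-sym)

Perm : Set → Set
Perm X = X ↔ X

_⟨$⟩_ : {X : Set} → Perm X → X → X
σ ⟨$⟩ x = Inverse.to σ x

_≈ₚ_ : {X : Set} → Perm X → Perm X → Set
σ ≈ₚ τ = ∀ x → σ ⟨$⟩ x ≡ τ ⟨$⟩ x

record PermGroup (X : Set) : Set₁ where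
  field
    _∈G     : Perm X → Set
    resp    : ∀ {σ τ} → σ ≈ₚ τ → σ ∈G → τ ∈G
    id∈     : ↔-id X ∈G
    comp∈   : ∀ {σ τ} → σ ∈G → τ ∈G → (σ ↔-∘ τ) ∈G
    inv∈    : ∀ {σ} → σ ∈G → ↔-sym σ ∈G
open PermGroup public

SamePair : {X : Set} → X → X → X → X → Set
SamePair u u' t t' = (u ≡ t × u' ≡ t') ⊎ (u ≡ t' × u' ≡ t)

SameNOrOrbital : {X : Set} → PermGroup X → X → X → X → X → Set
SameNOrOrbital C u u' t t' =
  ∃ λ c → (C ∈G) c × SamePair (c ⟨$⟩ u) (c ⟨$⟩ u') t t'

-- Automorphisms of an edge-colored graph on X, whose coloring is given by
-- E (only its values on pairs of distinct vertices matter).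
IsAut : {X : Set} → (X → X → ℕ) → Perm X → Set
IsAut E σ = ∀ v w → v ≢ w → E (σ ⟨$⟩ v) (σ ⟨$⟩ w) ≡ E v w

IsEdgeColoring : {X : Set} → (X → X → ℕ) → Set
IsEdgeColoring E = ∀ v w → v ≢ w → E v w ≡ E w v

IsOrbitalColoring : {X : Set} → PermGroup X → (X → X → ℕ) → Set
IsOrbitalColoring C E =
  IsEdgeColoring E ×
  (∀ u u' t t' → u ≢ u' → t ≢ t' →
     (E u u' ≡ E t t' → SameNOrOrbital C u u' t t') ×
     (SameNOrOrbital C u u' t t' → E u u' ≡ E t t'))

-- Membership in the closure Ā: permutations mapping every NOr-orbital of
-- A onto itself (τ and τ⁻¹ both map each orbital into itself).
InClosure : {X : Set} → PermGroup X → Perm X → Set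
InClosure A τ =
  (∀ v w → v ≢ w → SameNOrOrbital A (τ ⟨$⟩ v) (τ ⟨$⟩ w) v w) ×
  (∀ v w → v ≢ w → SameNOrOrbital A (↔-sym τ ⟨$⟩ v) (↔-sym τ ⟨$⟩ w) v w)

InProduct : {V W : Set} → (Perm V → Set) → (Perm W → Set) → Perm (V × W) → Set
InProduct P Q σ =
  ∃₂ λ a b → P a × Q b × (∀ x y → σ ⟨$⟩ (x , y) ≡ (a ⟨$⟩ x , b ⟨$⟩ y))

module _ {V W : Set} (A : PermGroup V) (B : PermGroup W) where
  open import Data.Product.Function.NonDependent.Propositional using (_×-↔_)
  open import Data.Product using (proj₁; proj₂)
  open import Relation.Binary.PropositionalEquality using (refl; trans; sym; cong₂)

  private
    mem : Perm (V × W) → Set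
    mem = InProduct (A ∈G) (B ∈G)

  directProduct : PermGroup (V × W)
  directProduct = record
    { _∈G  = mem
    ; resp = λ { {σ} {τ} eq (a , b , a∈ , b∈ , h) →
               a , b , a∈ , b∈ , λ x y → trans (sym (eq (x , y))) (h x y) }
    ; id∈  = ↔-id V , ↔-id W , id∈ A , id∈ B , λ x y → refl
    ; comp∈ = λ { {σ} {τ} (a , b , a∈ , b∈ , h) (a' , b' , a'∈ , b'∈ , h') →
               (a ↔-∘ a') , (b ↔-∘ b') , comp∈ A a∈ a'∈ , comp∈ B b∈ b'∈ ,
               λ x y → trans (cong-to σ (h' x y)) (h (a' ⟨$⟩ x) (b' ⟨$⟩ y)) }
    ; inv∈ = λ { {σ} (a , b , a∈ , b∈ , h) →
               ↔-sym a , ↔-sym b , inv∈ A a∈ , inv∈ B b∈ , λ x y → invLemma σ a b h x y }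
    }
    where
    cong-to : (σ : Perm (V × W)) {p q : V × W} → p ≡ q → σ ⟨$⟩ p ≡ σ ⟨$⟩ q
    cong-to σ refl = refl
    invLemma : (σ : Perm (V × W)) (a : Perm V) (b : Perm W) →
               (∀ x y → σ ⟨$⟩ (x , y) ≡ (a ⟨$⟩ x , b ⟨$⟩ y)) →
               ∀ x y → ↔-sym σ ⟨$⟩ (x , y) ≡ (↔-sym a ⟨$⟩ x , ↔-sym b ⟨$⟩ y)
    invLemma σ a b h x y =
      Inverse.inverseʳ σ (sym (trans (h (Inverse.from a x) (Inverse.from b y))
                                (cong₂ _,_ (Inverse.inverseˡ a refl) (Inverse.inverseˡ b refl))))

-- An automorphism σ of G(A × B) maps each edge into its own NOr-orbital, so some
-- (a , b) ∈ A × B carries {σ p , σ q} back onto {p , q}. If p and q share their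
-- first coordinate, applying a to the first coordinates shows that σ p and σ q
-- share theirs too; likewise for second coordinates. Hence σ permutes the rows
-- and columns of V × W and splits as σ (x , y) = (α x , β y), where α x is the
-- first coordinate of σ (x , y₀). Projecting the same orbital relation to the
-- row through y₀ (column through x₀) shows that α (β) preserves every
-- NOr-orbital of A (of B), i.e. α ∈ Ā and β ∈ B̄.
module Submission where

open import Defs
open import Data.Empty using (⊥-elim)
open import Data.Nat using (ℕ; zero; suc)
open import Data.Fin using (Fin; _≟_)
open import Data.Product using (_×_; _,_; proj₁; proj₂)
open import Data.Sum using (inj₁; inj₂)
open import Function using (_∘_)
open import Function.Bundles using (Inverse; Injection; mk↔ₛ′)
open import Function.Construct.Identity using (↔-id)
open import Function.Construct.Symmetry using (↔-sym)
open import Function.Properties.Inverse using (↔⇒↣)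
open import Relation.Binary.Definitions using (DecidableEquality)
open import Relation.Binary.PropositionalEquality
open import Relation.Nullary using (¬_; Dec; yes; no)

⟨$⟩-injective : {X : Set} (π : Perm X) {x y : X} → π ⟨$⟩ x ≡ π ⟨$⟩ y → x ≡ y
⟨$⟩-injective π = Injection.injective (↔⇒↣ π)

IsAut-sym : {X : Set} (E : X → X → ℕ) (σ : Perm X) → IsAut E σ → IsAut E (↔-sym σ)
IsAut-sym E σ aut v w v≢w = begin
  E (σ⁻ v) (σ⁻ w)              ≡⟨ aut (σ⁻ v) (σ⁻ w) σ⁻v≢σ⁻w ⟨
  E (σ ⟨$⟩ σ⁻ v) (σ ⟨$⟩ σ⁻ w)  ≡⟨ cong₂ E (Inverse.strictlyInverseˡ σ v)
                                          (Inverse.strictlyInverseˡ σ w) ⟩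
  E v w                        ∎
  where
  open ≡-Reasoning
  σ⁻ = Inverse.from σ
  σ⁻v≢σ⁻w : σ⁻ v ≢ σ⁻ w
  σ⁻v≢σ⁻w e = v≢w (⟨$⟩-injective (↔-sym σ) e)

SamePair-map : {X Y : Set} (f : X → Y) {u u' t t' : X} →
               SamePair u u' t t' → SamePair (f u) (f u') (f t) (f t')
SamePair-map f (inj₁ (e , e')) = inj₁ (cong f e , cong f e')
SamePair-map f (inj₂ (e , e')) = inj₂ (cong f e , cong f e')

SameNOrOrbital-degenerate : {X : Set} (C : PermGroup X) {u u' t : X} →
                            SameNOrOrbital C u u' t t → u ≡ u'
SameNOrOrbital-degenerate C (c , _ , inj₁ (e , e')) = ⟨$⟩-injective c (trans e (sym e'))
SameNOrOrbital-degenerate C (c , _ , inj₂ (e , e')) = ⟨$⟩-injective c (trans e (sym e'))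

InClosure-id : {X : Set} (A : PermGroup X) → InClosure A (↔-id X)
InClosure-id A = (λ _ _ _ → fixed) , (λ _ _ _ → fixed)
  where
  fixed : ∀ {v w} → SameNOrOrbital A v w v w
  fixed = ↔-id _ , id∈ A , inj₁ (refl , refl)

InProduct-InClosure-empty : {V W : Set} (A : PermGroup V) (B : PermGroup W) →
                            ¬ (V × W) → ∀ σ → InProduct (InClosure A) (InClosure B) σ
InProduct-InClosure-empty {V} {W} A B empty σ =
  ↔-id V , ↔-id W , InClosure-id A , InClosure-id B , λ x y → ⊥-elim (empty (x , y))

module _ {V W : Set} (A : PermGroup V) (B : PermGroup W) where

  SameNOrOrbital-proj₁ : ∀ {p q s t} → SameNOrOrbital (directProduct A B) p q s t →
                         SameNOrOrbital A (proj₁ p) (proj₁ q) (proj₁ s) (proj₁ t)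
  SameNOrOrbital-proj₁ (c , (a , _ , a∈ , _ , c≗a×b) , sp) =
    a , a∈ , subst₂ (λ u u' → SamePair u u' _ _)
                    (cong proj₁ (c≗a×b _ _)) (cong proj₁ (c≗a×b _ _))
                    (SamePair-map proj₁ sp)

  SameNOrOrbital-proj₂ : ∀ {p q s t} → SameNOrOrbital (directProduct A B) p q s t →
                         SameNOrOrbital B (proj₂ p) (proj₂ q) (proj₂ s) (proj₂ t)
  SameNOrOrbital-proj₂ (c , (_ , b , _ , b∈ , c≗a×b) , sp) =
    b , b∈ , subst₂ (λ u u' → SamePair u u' _ _)
                    (cong proj₂ (c≗a×b _ _)) (cong proj₂ (c≗a×b _ _))
                    (SamePair-map proj₂ sp)

PreservesRows : {V W : Set} → Perm (V × W) → Set
PreservesRows σ = ∀ x y y' → proj₁ (σ ⟨$⟩ (x , y)) ≡ proj₁ (σ ⟨$⟩ (x , y'))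

PreservesColumns : {V W : Set} → Perm (V × W) → Set
PreservesColumns σ = ∀ x x' y → proj₂ (σ ⟨$⟩ (x , y)) ≡ proj₂ (σ ⟨$⟩ (x' , y))

module _ {V W : Set} (σ : Perm (V × W)) where

  private
    σ⁻ : Perm (V × W)
    σ⁻ = ↔-sym σ

  rowPerm : W → PreservesRows σ → PreservesRows σ⁻ → Perm V
  rowPerm y₀ rows rows⁻ = mk↔ₛ′ (λ x → proj₁ (σ ⟨$⟩ (x , y₀))) (λ x → proj₁ (σ⁻ ⟨$⟩ (x , y₀)))
    (λ x → trans (rows _ y₀ _) (cong proj₁ (Inverse.strictlyInverseˡ σ (x , y₀))))
    (λ x → trans (rows⁻ _ y₀ _) (cong proj₁ (Inverse.strictlyInverseʳ σ (x , y₀))))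

  columnPerm : V → PreservesColumns σ → PreservesColumns σ⁻ → Perm W
  columnPerm x₀ cols cols⁻ = mk↔ₛ′ (λ y → proj₂ (σ ⟨$⟩ (x₀ , y))) (λ y → proj₂ (σ⁻ ⟨$⟩ (x₀ , y)))
    (λ y → trans (cols x₀ _ _) (cong proj₂ (Inverse.strictlyInverseˡ σ (x₀ , y))))
    (λ y → trans (cols⁻ x₀ _ _) (cong proj₂ (Inverse.strictlyInverseʳ σ (x₀ , y))))

  splits-as-rowPerm×columnPerm :
    (x₀ : V) (y₀ : W) (rows : PreservesRows σ) (rows⁻ : PreservesRows σ⁻)
    (cols : PreservesColumns σ) (cols⁻ : PreservesColumns σ⁻) →
    ∀ x y → σ ⟨$⟩ (x , y) ≡ (rowPerm y₀ rows rows⁻ ⟨$⟩ x , columnPerm x₀ cols cols⁻ ⟨$⟩ y)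
  splits-as-rowPerm×columnPerm x₀ y₀ rows _ cols _ x y =
    cong₂ _,_ (rows x y y₀) (cols x x₀ y)

module OrbitalColoring {V W : Set} (_≟V_ : DecidableEquality V) (_≟W_ : DecidableEquality W)
                       (A : PermGroup V) (B : PermGroup W) (E : V × W → V × W → ℕ)
                       (orbital : IsOrbitalColoring (directProduct A B) E) where

  private
    C : PermGroup (V × W)
    C = directProduct A B

    sameColour⇔sameOrbital : ∀ u u' t t' → u ≢ u' → t ≢ t' →
      (E u u' ≡ E t t' → SameNOrOrbital C u u' t t') × (SameNOrOrbital C u u' t t' → E u u' ≡ E t t')
    sameColour⇔sameOrbital = proj₂ orbital

  module _ (σ : Perm (V × W)) where

    private
      ≢-⟨$⟩ : ∀ {v w} → v ≢ w → σ ⟨$⟩ v ≢ σ ⟨$⟩ w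
      ≢-⟨$⟩ v≢w e = v≢w (⟨$⟩-injective σ e)

    ∈G⇒IsAut : (C ∈G) σ → IsAut E σ
    ∈G⇒IsAut σ∈ v w v≢w = proj₂ (sameColour⇔sameOrbital _ _ v w (≢-⟨$⟩ v≢w) v≢w)
      (↔-sym σ , inv∈ C {σ} σ∈ ,
       inj₁ (Inverse.strictlyInverseʳ σ v , Inverse.strictlyInverseʳ σ w))

    module _ (aut : IsAut E σ) where

      IsAut⇒SameNOrOrbital : ∀ v w → v ≢ w → SameNOrOrbital C (σ ⟨$⟩ v) (σ ⟨$⟩ w) v w
      IsAut⇒SameNOrOrbital v w v≢w =
        proj₁ (sameColour⇔sameOrbital _ _ v w (≢-⟨$⟩ v≢w) v≢w) (aut v w v≢w)

      IsAut⇒PreservesRows : PreservesRows σ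
      IsAut⇒PreservesRows x y y' with y ≟W y'
      ... | yes refl = refl
      ... | no y≢y' = SameNOrOrbital-degenerate A (SameNOrOrbital-proj₁ A B
                        (IsAut⇒SameNOrOrbital _ _ (λ e → y≢y' (cong proj₂ e))))

      IsAut⇒PreservesColumns : PreservesColumns σ
      IsAut⇒PreservesColumns x x' y with x ≟V x'
      ... | yes refl = refl
      ... | no x≢x' = SameNOrOrbital-degenerate B (SameNOrOrbital-proj₂ A B
                        (IsAut⇒SameNOrOrbital _ _ (λ e → x≢x' (cong proj₁ e))))

      row-SameNOrOrbital : ∀ y₀ v w → v ≢ w →
        SameNOrOrbital A (proj₁ (σ ⟨$⟩ (v , y₀))) (proj₁ (σ ⟨$⟩ (w , y₀))) v w
      row-SameNOrOrbital y₀ v w v≢w =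
        SameNOrOrbital-proj₁ A B (IsAut⇒SameNOrOrbital _ _ (λ e → v≢w (cong proj₁ e)))

      column-SameNOrOrbital : ∀ x₀ v w → v ≢ w →
        SameNOrOrbital B (proj₂ (σ ⟨$⟩ (x₀ , v))) (proj₂ (σ ⟨$⟩ (x₀ , w))) v w
      column-SameNOrOrbital x₀ v w v≢w =
        SameNOrOrbital-proj₂ A B (IsAut⇒SameNOrOrbital _ _ (λ e → v≢w (cong proj₂ e)))

  IsAut⇒InProduct-InClosure-at : V → W → ∀ σ → IsAut E σ → InProduct (InClosure A) (InClosure B) σ
  IsAut⇒InProduct-InClosure-at x₀ y₀ σ aut =
    rowPerm σ y₀ rows rows⁻ , columnPerm σ x₀ cols cols⁻ ,
    (row-SameNOrOrbital σ aut y₀ , row-SameNOrOrbital σ⁻ aut⁻ y₀) ,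
    (column-SameNOrOrbital σ aut x₀ , column-SameNOrOrbital σ⁻ aut⁻ x₀) ,
    splits-as-rowPerm×columnPerm σ x₀ y₀ rows rows⁻ cols cols⁻
    where
    σ⁻   = ↔-sym σ
    aut⁻ = IsAut-sym E σ aut
    rows  = IsAut⇒PreservesRows σ aut
    rows⁻ = IsAut⇒PreservesRows σ⁻ aut⁻
    cols  = IsAut⇒PreservesColumns σ aut
    cols⁻ = IsAut⇒PreservesColumns σ⁻ aut⁻

  IsAut⇒InProduct-InClosure : Dec V → Dec W →
                               ∀ σ → IsAut E σ → InProduct (InClosure A) (InClosure B) σ
  IsAut⇒InProduct-InClosure (yes x₀) (yes y₀) = IsAut⇒InProduct-InClosure-at x₀ y₀
  IsAut⇒InProduct-InClosure (no ¬V)  _        = λ σ _ → InProduct-InClosure-empty A B (¬V ∘ proj₁) σ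
  IsAut⇒InProduct-InClosure (yes _)  (no ¬W)  = λ σ _ → InProduct-InClosure-empty A B (¬W ∘ proj₂) σ

Fin-inhabited? : ∀ n → Dec (Fin n)
Fin-inhabited? zero    = no λ ()
Fin-inhabited? (suc n) = yes Fin.zero

fact2p2 : (n m : ℕ) → n ≢ 1 → m ≢ 1 →
    (A : PermGroup (Fin n)) (B : PermGroup (Fin m)) →
    (E : Fin n × Fin m → Fin n × Fin m → ℕ) →
    IsOrbitalColoring (directProduct A B) E →
    (∀ σ → (directProduct A B ∈G) σ → IsAut E σ) ×
    (∀ σ → IsAut E σ → InProduct (InClosure A) (InClosure B) σ)
fact2p2 n m _ _ A B E orbital =
  ∈G⇒IsAut , IsAut⇒InProduct-InClosure (Fin-inhabited? n) (Fin-inhabited? m)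
  where open OrbitalColoring _≟_ _≟_ A B E orbital
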